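{- Let $X$ be a set (the universe of possible hidden objects), let $f$ be a function on $X$, and let $\mathcal{Q}$ be a family of allowed questions, each question $q\in\mathcal{Q}$ being a function on $X$ (its correct answer for hidden object $x$ being $q(x)$; answers need not be yes/no). The answers are given by an adversary who may lie (give an answer different from the correct one for the hidden object) at most $k$ times. Suppose some questions have already been asked and the answers received are consistent, i.e. there exists $x\in X$ for which all of these answers are correct. If the value of $f$ is not yet determined, then at least $k+1$ further questions are needed to determine it (in the worst case over the adversary's answers).
   Context: An element $y\in X$ is still possible after a sequence of questions and answers if at most $k$ of the received answers differ from the correct answers for $y$. The value of $f$ is determined when all still-possible elements $y$ have the same value $f(y)$. -}

module Defs where

open import Data.Nat using (ℕ; zero; suc)
open import Data.Product using (Σ; _×_; _,_)
open import Data.Sum using (_⊎_)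
open import Data.List using (List; []; _∷_)
open import Data.List.Relation.Unary.All using (All)
open import Relation.Binary.PropositionalEquality using (_≡_)

-- A history: the list of (question, received answer) pairs so far
-- (most recent first; order is irrelevant for everything below).
History : (X A : Set) → Set
History X A = List ((X → A) × A)

AllCorrect : {X A : Set} → X → History X A → Set
AllCorrect y h = All (λ qa → let (q , a) = qa in q y ≡ a) h

Consistent : {X A : Set} → History X A → Set
Consistent {X} h = Σ X λ x → AllCorrect x h

-- WithinErrors m y h : at most m of the answers in h differ from the
-- correct answers for y.  (Inductively: every answer that is not charged
-- to the error budget must be correct for y.)
data WithinErrors {X A : Set} : ℕ → X → History X A → Set where
  nil   : ∀ {m y} → WithinErrors m y []
  right : ∀ {m y q a h} → q y ≡ a → WithinErrors m y h →
          WithinErrors m y ((q , a) ∷ h)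
  wrong : ∀ {m y q a h} → WithinErrors m y h →
          WithinErrors (suc m) y ((q , a) ∷ h)

StillPossible : {X A : Set} → ℕ → X → History X A → Set
StillPossible k y h = WithinErrors k y h

Determined : {X A B : Set} → (X → B) → ℕ → History X A → Set
Determined {X} f k h = (y z : X) → StillPossible k y h → StillPossible k z h → f y ≡ f z

-- CanDetermine Q f k n h : starting from history h, the questioner has an
-- (adaptive) strategy that, using at most n further questions from Q,
-- determines f whatever the adversary answers (the adversary may answer
-- anything; it is bound by the lie budget only through which elements
-- remain possible).
CanDetermine : {X A B : Set} → ((X → A) → Set) → (X → B) → ℕ → ℕ → History X A → Set
CanDetermine Q f k zero    h = Determined f k h
CanDetermine {X} {A} Q f k (suc n) h =
  Determined f k h ⊎
  Σ (X → A) λ q → Q q × ((a : A) → CanDetermine Q f k n ((q , a) ∷ h))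

module Submission where

-- Fix x₀ for which every answer received so far is correct,
-- and an arbitrary still-possible element w.  The adversary answers every
-- further question truthfully for w.  Each such answer costs x₀ at most one
-- lie, so after n further questions x₀ has used at most n lies; as long as
-- n ≤ k, both x₀ and w are still possible.  A strategy that determines f
-- within k questions therefore ends in a history where x₀ and w are both
-- still possible, forcing f x₀ ≡ f w.  As w was arbitrary, f is constant on
-- the still-possible elements of the original history, i.e. already
-- determined there, contradicting the hypothesis.

open import Defs
open import Data.Nat using (ℕ; zero; suc; _+_; _≤_; s≤s)
open import Data.Nat.Properties using (≤-refl; ≤-trans; m≤m+n; +-suc)
open import Data.Product using (proj₁; _,_)
open import Data.Sum using (inj₁; inj₂)
open import Data.List using (_∷_)
open import Data.List.Relation.Unary.All using (All; []; _∷_)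
open import Relation.Nullary using (¬_)
open import Relation.Binary.PropositionalEquality using (_≡_; refl; sym; trans; subst)

withinErrors-mono : {X A : Set} {m m′ : ℕ} {y : X} {h : History X A} →
  m ≤ m′ → WithinErrors m y h → WithinErrors m′ y h
withinErrors-mono m≤m′       nil         = nil
withinErrors-mono m≤m′       (right e w) = right e (withinErrors-mono m≤m′ w)
withinErrors-mono (s≤s m≤m′) (wrong w)   = wrong (withinErrors-mono m≤m′ w)

allCorrect⇒withinErrors : {X A : Set} {y : X} {h : History X A} →
  AllCorrect y h → WithinErrors 0 y h
allCorrect⇒withinErrors []      = nil
allCorrect⇒withinErrors (e ∷ c) = right e (allCorrect⇒withinErrors c)

adversary-keeps-both : {X A B : Set} (Q : (X → A) → Set) (f : X → B) (k : ℕ)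
  {x₀ w : X} (n j : ℕ) (h : History X A) →
  WithinErrors j x₀ h → StillPossible k w h → j + n ≤ k →
  CanDetermine Q f k n h → f x₀ ≡ f w
adversary-keeps-both Q f k zero j h x₀-ok w-ok j≤k determined =
  determined _ _ (withinErrors-mono (≤-trans (m≤m+n j 0) j≤k) x₀-ok) w-ok
adversary-keeps-both Q f k (suc n) j h x₀-ok w-ok j+n≤k (inj₁ determined) =
  determined _ _ (withinErrors-mono (≤-trans (m≤m+n j (suc n)) j+n≤k) x₀-ok) w-ok
adversary-keeps-both Q f k {w = w} (suc n) j h x₀-ok w-ok j+n≤k (inj₂ (q , _ , next)) =
  adversary-keeps-both Q f k n (suc j) ((q , q w) ∷ h)
    (wrong x₀-ok) (right refl w-ok) (subst (_≤ k) (+-suc j n) j+n≤k) (next (q w))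

constant-on-possible⇒determined : {X A B : Set} (f : X → B) (k : ℕ) (h : History X A) (x₀ : X) →
  ((w : X) → StillPossible k w h → f x₀ ≡ f w) → Determined f k h
constant-on-possible⇒determined f k h x₀ agrees y z y-ok z-ok =
  trans (sym (agrees y y-ok)) (agrees z z-ok)

claim2 : {X A B : Set} (Q : (X → A) → Set) (f : X → B) (k : ℕ) (h : History X A) →
    All (λ qa → Q (proj₁ qa)) h → Consistent h → ¬ Determined f k h →
    ¬ CanDetermine Q f k k h
claim2 Q f k h _ (x₀ , x₀-correct) undetermined strategy =
  undetermined (constant-on-possible⇒determined f k h x₀ λ w w-ok →
    adversary-keeps-both Q f k k 0 h (allCorrect⇒withinErrors x₀-correct) w-ok ≤-refl strategy)
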